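{- Let $\mathcal{M}=(E,r,m)$ be a ranked set with multiplicity. Then, with indeterminates $s,u_e,v_e$, $$\mathbf{Z}_{\mathcal{M}}\bigl(s,(u_ev_e)_{e\in E}\bigr)=\sum_{A\subseteq E}s^{ -r(A)}\prod_{e\in A}(-v_e)(1-u_e)\;\mathbf{Z}_{\mathcal{M}/A}\bigl(s,(v_e)_{e\in E\setminus A}\bigr).$$
   Context: A ranked set with multiplicity (rsm) is $\mathcal{M}=(E,r,m)$ with $E$ finite, $r:2^E\to\mathbb{Z}$ arbitrary ($r(\emptyset)$ may be nonzero), $m:2^E\to R$ arbitrary, $R$ a commutative ring with $1$. $\mathbf{Z}_{\mathcal{M}}(q,(v_e))=\sum_{A\subseteq E}m(A)q^{ -r(A)}\prod_{e\in A}v_e$. Contraction $\mathcal{M}/A=(E\setminus A,r',m')$ with $r'(B)=r(B\cup A)-r(A)$, $m'(B)=m(B\cup A)$. -}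

module Defs where

open import Level using (Level; _⊔_)
open import Data.Nat using (ℕ; zero; suc)
open import Data.Integer using (ℤ; +_; -[1+_]) renaming (_-_ to _-ℤ_)
open import Data.Bool using (true; false)
open import Data.Fin using (Fin; zero; suc)
open import Data.Fin.Subset using (Subset; _∪_; inside; outside)
open import Data.Vec using ([]; _∷_)
open import Data.List using (List; []; _∷_; map; _++_)
open import Algebra.Bundles using (CommutativeRing)

allSubsets : (n : ℕ) → List (Subset n)
allSubsets zero    = [] ∷ []
allSubsets (suc n) = map (outside ∷_) (allSubsets n) ++ map (inside ∷_) (allSubsets n)

ncompl : ∀ {n} → Subset n → ℕ
ncompl []          = zero
ncompl (true ∷ A)  = ncompl A
ncompl (false ∷ A) = suc (ncompl A)

-- Order-preserving enumeration Fin (|E ∖ A|) → E of the complement E ∖ A.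
embed : ∀ {n} (A : Subset n) → Fin (ncompl A) → Fin n
embed (true ∷ A)  i       = suc (embed A i)
embed (false ∷ A) zero    = zero
embed (false ∷ A) (suc i) = suc (embed A i)

-- Image in E of a subset B ⊆ E ∖ A (under embed A).
liftSub : ∀ {n} (A : Subset n) → Subset (ncompl A) → Subset n
liftSub []          []      = []
liftSub (true ∷ A)  B       = false ∷ liftSub A B
liftSub (false ∷ A) (b ∷ B) = b ∷ liftSub A B

module Over {c ℓ : Level} (R : CommutativeRing c ℓ) where
  open CommutativeRing R hiding (zero)

  record RSM (n : ℕ) : Set c where
    field
      rank : Subset n → ℤ
      mult : Subset n → Carrier
  open RSM public

  -- Contraction M / A, ground set E ∖ A (identified with Fin (ncompl A) via embed A).
  contract : ∀ {n} → RSM n → (A : Subset n) → RSM (ncompl A)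
  rank (contract M A) B = rank M (liftSub A B ∪ A) -ℤ rank M A
  mult (contract M A) B = mult M (liftSub A B ∪ A)

  ∑ : ∀ {a} {X : Set a} → List X → (X → Carrier) → Carrier
  ∑ []       f = 0#
  ∑ (x ∷ xs) f = f x + ∑ xs f

  prodOver : ∀ {n} → Subset n → (Fin n → Carrier) → Carrier
  prodOver []          w = 1#
  prodOver (true ∷ A)  w = w zero * prodOver A (λ i → w (suc i))
  prodOver (false ∷ A) w = prodOver A (λ i → w (suc i))

  pow : Carrier → ℕ → Carrier
  pow x zero    = 1#
  pow x (suc k) = x * pow x k

  -- integer power s^k of a unit s with given inverse sinv
  zpow : Carrier → Carrier → ℤ → Carrier
  zpow s sinv (+ k)     = pow s k
  zpow s sinv -[1+ k ]  = pow sinv (suc k)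

  Z : ∀ {n} → RSM n → (s sinv : Carrier) → (Fin n → Carrier) → Carrier
  Z {n} M s sinv v =
    ∑ (allSubsets n) (λ A → mult M A * zpow s sinv (Data.Integer.- rank M A) * prodOver A v)

module Submission where

-- Write x_e = u_e v_e as x_e = v_e + w_e with
-- w_e = (-v_e)(1 - u_e).  For ANY coefficient function g on subsets,
-- expanding each product ∏_{e∈B}(v_e + w_e) and collecting terms by the
-- set A ⊆ B of w-factors gives the subset-convolution identity
--   ∑_B g(B) ∏_{e∈B} x_e = ∑_A ∏_{e∈A} w_e · ∑_{C ⊆ E∖A} g(C ∪ A) ∏_{e∈C} v_e,
-- proved by induction on |E|, peeling off the first element of the ground
-- set (both sides split into the parts "e ∉" and "e ∈" the subset).
-- The theorem is the case g(B) = m(B) s^{-r(B)}: the inner sum is then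
-- s^{-r(A)} Z_{M/A}, because s^{-r(A)} s^{-(r(C∪A) - r(A))} = s^{-r(C∪A)}.

open import Defs
open import Data.Nat using (ℕ)
open import Data.Fin using (Fin)
open import Function using (_∘_)
open import Algebra.Bundles using (CommutativeRing)
import Data.Integer as ℤ

open import Level using (Level)
import Data.Nat as ℕ
open import Data.Nat using (zero; suc; z≤n; s≤s)
open import Data.Fin using (zero; suc)
open import Data.List using (List; []; _∷_; map; _++_)
open import Data.Vec using (_∷_)
open import Data.Fin.Subset using (Subset; _∪_; inside; outside)
open import Data.Product using (∃₂; _,_)
open import Relation.Binary.PropositionalEquality as ≡ using (_≡_)
import Data.Integer.Properties as ℤ
import Data.Integer.Tactic.RingSolver as ℤSolver
import Relation.Binary.Reasoning.Setoid as SetoidReasoning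
import Algebra.Properties.Ring as RingProperties
import Algebra.Properties.AbelianGroup as AbelianGroupProperties
import Algebra.Properties.CommutativeSemigroup as CommutativeSemigroupProperties

as-⊖ : ∀ a → ∃₂ λ p q → a ≡ p ℤ.⊖ q
as-⊖ (ℤ.+ p)      = p , 0 , ≡.sym (ℤ.⊖-≥ z≤n)
as-⊖ ℤ.-[1+ k ]  = 0 , suc k , ≡.sym (ℤ.⊖-< (s≤s z≤n))

⊖-+ : ∀ p q p′ q′ → (p ℤ.⊖ q) ℤ.+ (p′ ℤ.⊖ q′) ≡ (p ℕ.+ p′) ℤ.⊖ (q ℕ.+ q′)
⊖-+ p q p′ q′ = begin
    (p ℤ.⊖ q) ℤ.+ (p′ ℤ.⊖ q′)
  ≡⟨ ≡.cong₂ ℤ._+_ (ℤ.[+m]-[+n]≡m⊖n p q) (ℤ.[+m]-[+n]≡m⊖n p′ q′) ⟨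
    (ℤ.+ p ℤ.- ℤ.+ q) ℤ.+ (ℤ.+ p′ ℤ.- ℤ.+ q′)
  ≡⟨ regroup (ℤ.+ p) (ℤ.+ q) (ℤ.+ p′) (ℤ.+ q′) ⟩
    (ℤ.+ p ℤ.+ ℤ.+ p′) ℤ.- (ℤ.+ q ℤ.+ ℤ.+ q′)
  ≡⟨ ≡.cong₂ ℤ._-_ (ℤ.pos-+ p p′) (ℤ.pos-+ q q′) ⟨
    ℤ.+ (p ℕ.+ p′) ℤ.- ℤ.+ (q ℕ.+ q′)
  ≡⟨ ℤ.[+m]-[+n]≡m⊖n (p ℕ.+ p′) (q ℕ.+ q′) ⟩
    (p ℕ.+ p′) ℤ.⊖ (q ℕ.+ q′)
  ∎
  where
  open ≡.≡-Reasoning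
  regroup : ∀ a b c d → (a ℤ.- b) ℤ.+ (c ℤ.- d) ≡ (a ℤ.+ c) ℤ.- (b ℤ.+ d)
  regroup = ℤSolver.solve-∀

module Expansion {c ℓ : Level} (R : CommutativeRing c ℓ) where
  open CommutativeRing R hiding (zero)
  open Over R
  open SetoidReasoning setoid
  open RingProperties ring using (-‿distribˡ-*; x[y-z]≈xy-xz)
  open AbelianGroupProperties +-abelianGroup using (⁻¹-anti-homo‿-; xyx⁻¹≈y)
  module + = CommutativeSemigroupProperties +-commutativeSemigroup
  module * = CommutativeSemigroupProperties *-commutativeSemigroup

  ∑-cong : ∀ {a} {X : Set a} (xs : List X) {f g : X → Carrier} →
           (∀ x → f x ≈ g x) → ∑ xs f ≈ ∑ xs g
  ∑-cong []       f≈g = refl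
  ∑-cong (x ∷ xs) f≈g = +-cong (f≈g x) (∑-cong xs f≈g)

  ∑-++ : ∀ {a} {X : Set a} (xs ys : List X) (f : X → Carrier) →
         ∑ (xs ++ ys) f ≈ ∑ xs f + ∑ ys f
  ∑-++ []       ys f = sym (+-identityˡ _)
  ∑-++ (x ∷ xs) ys f = trans (+-congˡ (∑-++ xs ys f)) (sym (+-assoc _ _ _))

  ∑-map : ∀ {a b} {X : Set a} {Y : Set b} (h : X → Y) (xs : List X) (f : Y → Carrier) →
          ∑ (map h xs) f ≡ ∑ xs (f ∘ h)
  ∑-map h []       f = ≡.refl
  ∑-map h (x ∷ xs) f = ≡.cong (f (h x) +_) (∑-map h xs f)

  ∑-+ : ∀ {a} {X : Set a} (xs : List X) (f g : X → Carrier) →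
        ∑ xs (λ x → f x + g x) ≈ ∑ xs f + ∑ xs g
  ∑-+ []       f g = sym (+-identityˡ _)
  ∑-+ (x ∷ xs) f g = trans (+-congˡ (∑-+ xs f g)) (+.interchange _ _ _ _)

  ∑-* : ∀ {a} {X : Set a} (xs : List X) (k : Carrier) (f : X → Carrier) →
        ∑ xs (λ x → k * f x) ≈ k * ∑ xs f
  ∑-* []       k f = sym (zeroʳ k)
  ∑-* (x ∷ xs) k f = trans (+-congˡ (∑-* xs k f)) (sym (distribˡ k _ _))

  ∑-allSubsets-suc : ∀ n (f : Subset (suc n) → Carrier) →
    ∑ (allSubsets (suc n)) f
      ≈ ∑ (allSubsets n) (λ B → f (outside ∷ B)) + ∑ (allSubsets n) (λ B → f (inside ∷ B))
  ∑-allSubsets-suc n f = trans (∑-++ (map (outside ∷_) S) _ f)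
    (reflexive (≡.cong₂ _+_ (∑-map (outside ∷_) S f) (∑-map (inside ∷_) S f)))
    where S = allSubsets n

  generating : ∀ n → (Subset n → Carrier) → (Fin n → Carrier) → Carrier
  generating n g x = ∑ (allSubsets n) (λ B → g B * prodOver B x)

  contractCoeff : ∀ {n} → (Subset n → Carrier) → (A : Subset n) → Subset (ncompl A) → Carrier
  contractCoeff g A C = g (liftSub A C ∪ A)

  convolution : ∀ n → (Subset n → Carrier) → (w v : Fin n → Carrier) → Carrier
  convolution n g w v =
    ∑ (allSubsets n) (λ A → prodOver A w * generating (ncompl A) (contractCoeff g A) (v ∘ embed A))

  generating-suc : ∀ n (g : Subset (suc n) → Carrier) (x : Fin (suc n) → Carrier) →
    generating (suc n) g x
      ≈ generating n (g ∘ (outside ∷_)) (x ∘ suc) + x zero * generating n (g ∘ (inside ∷_)) (x ∘ suc)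
  generating-suc n g x = trans (∑-allSubsets-suc n _)
    (+-congˡ (trans (∑-cong (allSubsets n) (λ B → *.x∙yz≈y∙xz (g (inside ∷ B)) (x zero) _))
                    (∑-* (allSubsets n) (x zero) _)))

  -- A set A ∌ 0 contributes,
  -- through the inner generating function, both a g₀-term and a v₀-weighted
  -- g₁-term; a set A ∋ 0 contributes a w₀-weighted g₁-term.
  convolution-suc : ∀ n (g : Subset (suc n) → Carrier) (w v : Fin (suc n) → Carrier) →
    let E₀ = convolution n (g ∘ (outside ∷_)) (w ∘ suc) (v ∘ suc)
        E₁ = convolution n (g ∘ (inside ∷_)) (w ∘ suc) (v ∘ suc)
    in convolution (suc n) g w v ≈ (E₀ + v zero * E₁) + w zero * E₁
  convolution-suc n g w v = begin
      convolution (suc n) g w v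
    ≈⟨ ∑-allSubsets-suc n _ ⟩
      ∑ S (λ A → P A * generating (suc (ncompl A)) (contractCoeff g (outside ∷ A)) (v ∘ embed (outside ∷ A)))
        + ∑ S (λ A → (w zero * P A) * K₁ A)
    ≈⟨ +-cong (∑-cong S avoiding) (∑-cong S (λ A → *-assoc (w zero) (P A) (K₁ A))) ⟩
      ∑ S (λ A → P A * K₀ A + v zero * (P A * K₁ A)) + ∑ S (λ A → w zero * (P A * K₁ A))
    ≈⟨ +-cong (trans (∑-+ S _ _) (+-congˡ (∑-* S (v zero) _))) (∑-* S (w zero) _) ⟩
      (∑ S (λ A → P A * K₀ A) + v zero * ∑ S (λ A → P A * K₁ A)) + w zero * ∑ S (λ A → P A * K₁ A)
    ∎
    where
    S = allSubsets n
    P : Subset n → Carrier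
    P A = prodOver A (w ∘ suc)
    K₀ K₁ : Subset n → Carrier
    K₀ A = generating (ncompl A) (contractCoeff (g ∘ (outside ∷_)) A) (v ∘ suc ∘ embed A)
    K₁ A = generating (ncompl A) (contractCoeff (g ∘ (inside ∷_)) A) (v ∘ suc ∘ embed A)
    avoiding : ∀ A → P A * generating (suc (ncompl A)) (contractCoeff g (outside ∷ A)) (v ∘ embed (outside ∷ A))
                     ≈ P A * K₀ A + v zero * (P A * K₁ A)
    avoiding A = trans (*-congˡ (generating-suc (ncompl A) _ _))
      (trans (distribˡ (P A) (K₀ A) _) (+-congˡ (*.x∙yz≈y∙xz (P A) (v zero) (K₁ A))))

  generating≈convolution : ∀ n (g : Subset n → Carrier) (x v w : Fin n → Carrier) →
    (∀ e → x e ≈ v e + w e) → generating n g x ≈ convolution n g w v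
  generating≈convolution zero    g x v w x≈v+w = sym (trans (+-identityʳ _) (*-identityˡ _))
  generating≈convolution (suc n) g x v w x≈v+w = begin
      generating (suc n) g x
    ≈⟨ generating-suc n g x ⟩
      generating n g₀ (x ∘ suc) + x zero * generating n g₁ (x ∘ suc)
    ≈⟨ +-cong (induct g₀) (*-cong (x≈v+w zero) (induct g₁)) ⟩
      E g₀ + (v zero + w zero) * E g₁
    ≈⟨ trans (+-congˡ (distribʳ (E g₁) (v zero) (w zero))) (sym (+-assoc _ _ _)) ⟩
      (E g₀ + v zero * E g₁) + w zero * E g₁
    ≈⟨ convolution-suc n g w v ⟨
      convolution (suc n) g w v
    ∎
    where
    g₀ g₁ : Subset n → Carrier
    g₀ = g ∘ (outside ∷_)
    g₁ = g ∘ (inside ∷_)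
    E : (Subset n → Carrier) → Carrier
    E h = convolution n h (w ∘ suc) (v ∘ suc)
    induct : ∀ h → generating n h (x ∘ suc) ≈ E h
    induct h = generating≈convolution n h (x ∘ suc) (v ∘ suc) (w ∘ suc) (x≈v+w ∘ suc)

  uv-split : ∀ u v → u * v ≈ v + (- v) * (1# - u)
  uv-split u v = sym (begin
      v + (- v) * (1# - u)
    ≈⟨ +-congˡ (-‿distribˡ-* v (1# - u)) ⟨
      v + - (v * (1# - u))
    ≈⟨ +-congˡ (-‿cong (trans (x[y-z]≈xy-xz v 1# u) (+-congʳ (*-identityʳ v)))) ⟩
      v + - (v - v * u)
    ≈⟨ +-congˡ (⁻¹-anti-homo‿- v (v * u)) ⟩
      v + (v * u - v)
    ≈⟨ +-assoc v (v * u) (- v) ⟨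
      v + v * u - v
    ≈⟨ xyx⁻¹≈y v (v * u) ⟩
      v * u
    ≈⟨ *-comm v u ⟩
      u * v
    ∎)

  -- Fix a unit s with inverse sinv.  Its integer powers are additive in the
  -- exponent, which makes the rank shift in a contraction telescope.
  module UnitPowers (s sinv : Carrier) (s*sinv≈1 : s * sinv ≈ 1#) where

    pow-+ : ∀ x p q → pow x (p ℕ.+ q) ≈ pow x p * pow x q
    pow-+ x zero    q = sym (*-identityˡ _)
    pow-+ x (suc p) q = trans (*-congˡ (pow-+ x p q)) (sym (*-assoc _ _ _))

    zpow-⊖ : ∀ p q → zpow s sinv (p ℤ.⊖ q) ≈ pow s p * pow sinv q
    zpow-⊖ p       zero    rewrite ℤ.⊖-≥ {p} {0} z≤n = sym (*-identityʳ _)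
    zpow-⊖ zero    (suc q) rewrite ℤ.⊖-< {0} {suc q} (s≤s z≤n) = sym (*-identityˡ _)
    zpow-⊖ (suc p) (suc q) rewrite ℤ.[1+m]⊖[1+n]≡m⊖n p q = begin
        zpow s sinv (p ℤ.⊖ q)
      ≈⟨ zpow-⊖ p q ⟩
        pow s p * pow sinv q
      ≈⟨ trans (*-congʳ s*sinv≈1) (*-identityˡ _) ⟨
        (s * sinv) * (pow s p * pow sinv q)
      ≈⟨ *.interchange s (pow s p) sinv (pow sinv q) ⟨
        pow s (suc p) * pow sinv (suc q)
      ∎

    zpow-+ : ∀ a b → zpow s sinv (a ℤ.+ b) ≈ zpow s sinv a * zpow s sinv b
    zpow-+ a b with as-⊖ a | as-⊖ b
    ... | p , q , ≡.refl | p′ , q′ , ≡.refl = begin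
        zpow s sinv ((p ℤ.⊖ q) ℤ.+ (p′ ℤ.⊖ q′))
      ≡⟨ ≡.cong (zpow s sinv) (⊖-+ p q p′ q′) ⟩
        zpow s sinv ((p ℕ.+ p′) ℤ.⊖ (q ℕ.+ q′))
      ≈⟨ zpow-⊖ (p ℕ.+ p′) (q ℕ.+ q′) ⟩
        pow s (p ℕ.+ p′) * pow sinv (q ℕ.+ q′)
      ≈⟨ *-cong (pow-+ s p p′) (pow-+ sinv q q′) ⟩
        (pow s p * pow s p′) * (pow sinv q * pow sinv q′)
      ≈⟨ *.interchange _ _ _ _ ⟩
        (pow s p * pow sinv q) * (pow s p′ * pow sinv q′)
      ≈⟨ *-cong (zpow-⊖ p q) (zpow-⊖ p′ q′) ⟨
        zpow s sinv (p ℤ.⊖ q) * zpow s sinv (p′ ℤ.⊖ q′)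
      ∎

    rsmCoeff : ∀ {n} → RSM n → Subset n → Carrier
    rsmCoeff M B = mult M B * zpow s sinv (ℤ.- rank M B)

    -- s^{-r(A)} Z_{M/A} is the generating function of the contracted
    -- coefficients of M, since s^{-r(A)} s^{-(r(C∪A) - r(A))} = s^{-r(C∪A)}.
    scaled-contraction : ∀ {n} (M : RSM n) (A : Subset n) (x : Fin (ncompl A) → Carrier) →
      zpow s sinv (ℤ.- rank M A) * Z (contract M A) s sinv x
        ≈ generating (ncompl A) (contractCoeff (rsmCoeff M) A) x
    scaled-contraction M A x = trans (sym (∑-* (allSubsets (ncompl A)) _ _))
      (∑-cong (allSubsets (ncompl A)) λ C → trans (rearrange _ _ _ _)
        (*-congʳ (*-congˡ (exponents (rank M A) (rank M (liftSub A C ∪ A))))))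
      where
      rearrange : ∀ z m z′ p → z * ((m * z′) * p) ≈ (m * (z * z′)) * p
      rearrange z m z′ p = trans (sym (*-assoc z (m * z′) p)) (*-congʳ (*.x∙yz≈y∙xz z m z′))
      exponents : ∀ r r′ → zpow s sinv (ℤ.- r) * zpow s sinv (ℤ.- (r′ ℤ.- r)) ≈ zpow s sinv (ℤ.- r′)
      exponents r r′ = trans (sym (zpow-+ (ℤ.- r) (ℤ.- (r′ ℤ.- r))))
        (reflexive (≡.cong (zpow s sinv) (telescope r r′)))
        where
        telescope : ∀ r r′ → ℤ.- r ℤ.+ ℤ.- (r′ ℤ.- r) ≡ ℤ.- r′
        telescope = ℤSolver.solve-∀

proposition3p27 : ∀ {c ℓ} (R : CommutativeRing c ℓ) →
    let open CommutativeRing R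
        open Over R
    in ∀ {n : ℕ} (M : RSM n) (s sinv : Carrier) → s * sinv ≈ 1# →
       (u v : Fin n → Carrier) →
       Z M s sinv (λ e → u e * v e)
         ≈ ∑ (allSubsets n) (λ A →
              zpow s sinv (ℤ.- rank M A)
                * prodOver A (λ e → (- v e) * (1# - u e))
                * Z (contract M A) s sinv (v ∘ embed A))
proposition3p27 R {n} M s sinv s*sinv≈1 u v =
  trans (generating≈convolution n (rsmCoeff M) (λ e → u e * v e) v w (λ e → uv-split (u e) (v e)))
        (∑-cong (allSubsets n) λ A →
          trans (*-congˡ (sym (scaled-contraction M A (v ∘ embed A))))
                (sym (xy∙z≈y∙xz _ _ _)))
  where
  open CommutativeRing R hiding (zero)
  open Over R
  open Expansion R
  open UnitPowers s sinv s*sinv≈1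
  open CommutativeSemigroupProperties *-commutativeSemigroup using (xy∙z≈y∙xz)
  w : Fin n → Carrier
  w e = (- v e) * (1# - u e)
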